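{- Let $n,m$ be such that $\mathcal{C}_{n,m}$ contains a Whitney-maximum graph. Then every uniformly most reliable graph in $\mathcal{C}_{n,m}$ is a $0$-element in $\mathcal{C}_{n,m}$.
   Context: $\mathcal{C}_{n,m}$ denotes the set of all connected simple graphs on $n$ vertices and $m$ edges. For a graph on $n$ vertices with $e$ edges and $\kappa$ connected components, its rank is $n-\kappa$ and its corank is $e-n+\kappa$; write $r(\cdot)$, $c(\cdot)$. $\mathcal{S}(G)$ is the set of spanning subgraphs of $G$. The Whitney polynomial is $W_G(x,y)=\sum_{H\in\mathcal{S}(G)}x^{r(G)-r(H)}y^{c(H)}$. A bivariate polynomial is nonnegative if it can be written as $\sum_{i,j}a_{ij}x^iy^j$ with finitely many real coefficients $a_{ij}\ge 0$. $G\in\mathcal{C}_{n,m}$ is Whitney-maximum if for every $H\in\mathcal{C}_{n,m}$ there is a nonnegative polynomial $Q_H$ with $W_G(x,y)-W_H(x,y)=(1-xy)Q_H(x,y)$. $N_i^{(1)}(G)$ is the number of connected spanning subgraphs of $G$ having exactly $i$ edges. The (all-terminal) reliability is $R_G^{(1)}(p)=\sum_{i=0}^m N_i^{(1)}(G)p^i(1-p)^{m-i}$ for $p\in[0,1]$. $G\in\mathcal{C}_{n,m}$ is uniformly most reliable if $R_G^{(1)}(p)\ge R_H^{(1)}(p)$ for all $H\in\mathcal{C}_{n,m}$ and all $p\in[0,1]$. $G\in\mathcal{C}_{n,m}$ is a $0$-element in $\mathcal{C}_{n,m}$ if $N_i^{(1)}(G)\ge N_i^{(1)}(H)$ for every $i\in\{0,\ldots,m\}$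 and every $H\in\mathcal{C}_{n,m}$. -}

module Defs where

open import Data.Bool using (Bool; true; false; _∧_; _∨_; not)
open import Data.Nat as ℕ using (ℕ; zero; suc; _∸_; _≡ᵇ_; _<ᵇ_)
open import Data.Fin using (Fin; toℕ)
open import Data.Fin.Properties using ()
open import Data.Product using (_×_; _,_; Σ; ∃)
open import Data.Sum using (_⊎_)
open import Data.List using (List; []; _∷_; length; map; _++_; filterᵇ; allFin; upTo; foldr)
open import Data.Bool.ListAction using (any; all)
open import Data.List.Relation.Unary.All using (All)
open import Data.List.Relation.Unary.Unique.Propositional using (Unique)
open import Data.Integer using (ℤ; +_)
open import Data.Rational using (ℚ; _/_; 0ℚ; 1ℚ; _+_; _*_; _-_; _≤_)
open import Relation.Binary.PropositionalEquality using (_≡_)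

-- An edge {u,v} is stored as the ordered pair (u , v) with u < v
-- (so no loops, no reversed duplicates); the edge list has no
-- duplicates (Unique).

Edge : ℕ → Set
Edge n = Fin n × Fin n

record SimpleGraph (n : ℕ) : Set where
  field
    edges   : List (Edge n)
    ordered : All (λ e → toℕ (Data.Product.proj₁ e) ℕ.< toℕ (Data.Product.proj₂ e)) edges
    unique  : Unique edges
open SimpleGraph public

numEdges : ∀ {n} → SimpleGraph n → ℕ
numEdges G = length (edges G)

_==F_ : ∀ {n} → Fin n → Fin n → Bool
u ==F v = toℕ u ≡ᵇ toℕ v

reach : ∀ {n} → List (Edge n) → ℕ → Fin n → Fin n → Bool
reach E zero    u v = u ==F v
reach E (suc k) u v =
  reach E k u v ∨
  any (λ e → (reach E k u (Data.Product.proj₁ e) ∧ (Data.Product.proj₂ e ==F v))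
           ∨ (reach E k u (Data.Product.proj₂ e) ∧ (Data.Product.proj₁ e ==F v))) E

-- u and v lie in the same connected component (walks of length ≤ n suffice)
sameComp : ∀ {n} → List (Edge n) → Fin n → Fin n → Bool
sameComp {n} E u v = reach E n u v

-- number of connected components κ: count the vertices that are the
-- smallest vertex of their component
components : (n : ℕ) → List (Edge n) → ℕ
components n E =
  length (filterᵇ (λ v → all (λ u → not ((toℕ u <ᵇ toℕ v) ∧ sameComp E u v)) (allFin n))
                  (allFin n))

rank : (n : ℕ) → List (Edge n) → ℕ
rank n E = n ∸ components n E

corank : (n : ℕ) → List (Edge n) → ℕ
corank n E = (length E ℕ.+ components n E) ∸ n

Connected : ∀ {n} → SimpleGraph n → Set
Connected {n} G = components n (edges G) ≡ 1

InC : (n m : ℕ) → SimpleGraph n → Set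
InC n m G = Connected G × numEdges G ≡ m

-- Spanning subgraphs of G: all sub(edge)lists of the edge list
-- (2^m of them, pairwise distinct as edge sets since edges are unique).

sublists : ∀ {A : Set} → List A → List (List A)
sublists []       = [] ∷ []
sublists (x ∷ xs) = map (x ∷_) (sublists xs) ++ sublists xs

spanning : ∀ {n} → SimpleGraph n → List (List (Edge n))
spanning G = sublists (edges G)

-- Whitney polynomial, given by its coefficient array:
-- coefficient of x^i y^j in W_G = #{H ∈ 𝒮(G) : r(G) − r(H) = i , c(H) = j}

whitneyCoef : ∀ {n} → SimpleGraph n → ℕ → ℕ → ℕ
whitneyCoef {n} G i j =
  length (filterᵇ (λ H → ((rank n (edges G) ∸ rank n H) ≡ᵇ i) ∧ (corank n H ≡ᵇ j))
                  (spanning G))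

ℕtoℚ : ℕ → ℚ
ℕtoℚ k = + k / 1

-- A nonnegative bivariate polynomial Σ a_ij x^i y^j: finitely many
-- (rational) coefficients, all ≥ 0 (coefficients vanish outside a box).
record NonnegPoly : Set where
  field
    coef    : ℕ → ℕ → ℚ
    bound   : ℕ
    nonneg  : ∀ i j → 0ℚ ≤ coef i j
    support : ∀ i j → bound ℕ.≤ i ⊎ bound ℕ.≤ j → coef i j ≡ 0ℚ
open NonnegPoly public

oneMinusXYTimes : NonnegPoly → ℕ → ℕ → ℚ
oneMinusXYTimes Q zero    j       = coef Q zero j
oneMinusXYTimes Q (suc i) zero    = coef Q (suc i) zero
oneMinusXYTimes Q (suc i) (suc j) = coef Q (suc i) (suc j) - coef Q i j

WhitneyDiffFactors : ∀ {n} → SimpleGraph n → SimpleGraph n → NonnegPoly → Set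
WhitneyDiffFactors G H Q =
  ∀ i j → ℕtoℚ (whitneyCoef G i j) - ℕtoℚ (whitneyCoef H i j) ≡ oneMinusXYTimes Q i j

WhitneyMaximum : (n m : ℕ) → SimpleGraph n → Set
WhitneyMaximum n m G =
  InC n m G × (∀ (H : SimpleGraph n) → InC n m H → Σ NonnegPoly (WhitneyDiffFactors G H))

N1 : ∀ {n} → SimpleGraph n → ℕ → ℕ
N1 {n} G i =
  length (filterᵇ (λ H → (components n H ≡ᵇ 1) ∧ (length H ≡ᵇ i)) (spanning G))

_^ℚ_ : ℚ → ℕ → ℚ
p ^ℚ zero  = 1ℚ
p ^ℚ suc k = p * (p ^ℚ k)

reliability : ∀ {n} → SimpleGraph n → ℚ → ℚ
reliability G p =
  foldr _+_ 0ℚ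
    (map (λ i → ℕtoℚ (N1 G i) * ((p ^ℚ i) * ((1ℚ - p) ^ℚ (numEdges G ∸ i))))
         (upTo (suc (numEdges G))))

UniformlyMostReliable : (n m : ℕ) → SimpleGraph n → Set
UniformlyMostReliable n m G =
  InC n m G ×
  (∀ (H : SimpleGraph n) → InC n m H →
     ∀ (p : ℚ) → 0ℚ ≤ p → p ≤ 1ℚ → reliability H p ≤ reliability G p)

ZeroElement : (n m : ℕ) → SimpleGraph n → Set
ZeroElement n m G =
  InC n m G ×
  (∀ (H : SimpleGraph n) → InC n m H → ∀ (i : ℕ) → i ℕ.≤ m → N1 H i ℕ.≤ N1 G i)

{-# OPTIONS --safe #-}
-- A Whitney-maximum G* is a 0-element: for a connected graph on n + 1 vertices the coefficient
-- of x⁰yʲ in its Whitney polynomial counts the connected spanning subgraphs with n + j edges,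
-- and the x⁰ coefficients of (1 − xy) Q are those of Q, hence nonnegative.  A uniformly most
-- reliable G satisfies R_G(½) ≥ R_{G*}(½), where every N_i carries a positive weight; as
-- N_i(G) ≤ N_i(G*) for all i, no inequality can be strict, so G inherits the maximality of G*.
-- Reading off x⁰ coefficients uses κ + e ≥ n for every edge list: adding an edge to E turns at
-- most one vertex that is least in its component into a non-least one.
module Submission where

open import Defs
open import Data.Nat using (ℕ)
open import Data.Product using (∃)
open import Function using (id; _∘_; _⇔_; mk⇔; Equivalence)
import Function.Properties.Equivalence as ⇔
open import Data.Bool using (Bool; true; false; T; not; _∧_)
open import Data.Bool.Properties using (T-∧; T-∨)
open import Data.Bool.ListAction using (all)
open import Data.Nat as ℕ using (zero; suc; _+_; _∸_; _≡ᵇ_; _<ᵇ_; _≤_; _<_; z≤n; s≤s)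
import Data.Nat.Properties as ℕ
import Data.Integer as ℤ
import Data.Integer.Properties as ℤ
open import Data.Rational as ℚ using (ℚ; 0ℚ; 1ℚ; ½; toℚᵘ)
import Data.Rational.Properties as ℚ
open import Data.Rational.Unnormalised as ℚᵘ using (mkℚᵘ) renaming (_≃_ to _≃ᵘ_)
import Data.Rational.Unnormalised.Properties as ℚᵘ
open import Data.Fin as Fin using (Fin; toℕ)
import Data.Fin.Properties as Fin
open import Data.Product using (_×_; _,_; proj₁; proj₂; map₁)
open import Data.Product.Function.NonDependent.Propositional using (_×-⇔_)
open import Data.Sum as Sum using (_⊎_; inj₁; inj₂)
open import Data.List using (List; []; _∷_; length; filter; allFin; tabulate; upTo; map; foldr)
open import Data.List.Properties
  using (length-filter; length-tabulate; filter-accept; filter-all; filter-none; filter-≐)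
open import Data.List.Relation.Unary.All as All using (All; []; _∷_)
import Data.List.Relation.Unary.All.Properties as All
open import Data.List.Relation.Unary.Any using (Any; here; there; satisfied)
open import Data.List.Relation.Unary.Any.Properties using (any⁻)
open import Data.List.Relation.Unary.Unique.Propositional using (Unique; []; _∷_)
import Data.List.Relation.Unary.Unique.Propositional.Properties as Unique
open import Data.List.Membership.Propositional using (_∈_; find; lose)
open import Data.List.Membership.Propositional.Properties using (∈-upTo⁺; ∈-upTo⁻)
open import Relation.Binary.Construct.Closure.ReflexiveTransitive
  using (Star; ε; _◅_; _◅◅_; return; reverse)
open import Relation.Binary.Definitions using (tri<; tri≈; tri>)
open import Relation.Binary.PropositionalEquality
  using (_≡_; _≢_; refl; sym; trans; cong; subst; subst₂; module ≡-Reasoning)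
open import Relation.Nullary using (¬_; Dec; yes; no; contradiction)
open import Relation.Nullary.Decidable using (T?; ¬?)
open import Relation.Unary using (Decidable)
open import Relation.Unary.Properties using (∁?)

module _ {n : ℕ} where

  Adjacent : List (Edge n) → Fin n → Fin n → Set
  Adjacent E u v = (u , v) ∈ E ⊎ (v , u) ∈ E

  infix 4 _~[_]_
  _~[_]_ : Fin n → List (Edge n) → Fin n → Set
  u ~[ E ] v = Star (Adjacent E) u v

  ~-sym : ∀ {E u v} → u ~[ E ] v → v ~[ E ] u
  ~-sym = reverse Sum.swap

  ==F⇒≡ : ∀ (u v : Fin n) → T (u ==F v) → u ≡ v
  ==F⇒≡ u v t = Fin.toℕ-injective (ℕ.≡ᵇ⇒≡ (toℕ u) (toℕ v) t)

  reach⇒~ : ∀ E k {u v} → T (reach E k u v) → u ~[ E ] v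
  reach⇒~ E zero {u} {v} u=v with refl ← ==F⇒≡ u v u=v = ε
  reach⇒~ E (suc k) {u} {v} r with Equivalence.to T-∨ r
  ... | inj₁ r′ = reach⇒~ E k r′
  ... | inj₂ r′ with (a , b) , ab∈E , t ← find (any⁻ _ E r′) | Equivalence.to T-∨ t
  ...   | inj₁ t′ with ua , bv ← Equivalence.to T-∧ t′ =
    subst (u ~[ E ]_) (==F⇒≡ b v bv) (reach⇒~ E k ua ◅◅ return (inj₁ ab∈E))
  ...   | inj₂ t′ with ub , av ← Equivalence.to T-∧ t′ =
    subst (u ~[ E ]_) (==F⇒≡ a v av) (reach⇒~ E k ub ◅◅ return (inj₂ ab∈E))

  Split : Edge n → List (Edge n) → Fin n → Fin n → Set
  Split (a , b) E u v = u ~[ E ] v ⊎ (u ~[ E ] a × b ~[ E ] v) ⊎ (u ~[ E ] b × a ~[ E ] v)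

  Split-◅ : ∀ {e E u x v} → Adjacent E u x → Split e E x v → Split e E u v
  Split-◅ s = Sum.map (s ◅_) (Sum.map (map₁ (s ◅_)) (map₁ (s ◅_)))

  ~-∷ : ∀ {e E u v} → u ~[ e ∷ E ] v → Split e E u v
  ~-∷ ε = inj₁ ε
  ~-∷ (inj₁ (there s) ◅ w) = Split-◅ (inj₁ s) (~-∷ w)
  ~-∷ (inj₂ (there s) ◅ w) = Split-◅ (inj₂ s) (~-∷ w)
  ~-∷ (inj₁ (here refl) ◅ w) with ~-∷ w
  ... | inj₁ bv              = inj₂ (inj₁ (ε , bv))
  ... | inj₂ (inj₁ (_ , bv)) = inj₂ (inj₁ (ε , bv))
  ... | inj₂ (inj₂ (_ , av)) = inj₁ av
  ~-∷ (inj₂ (here refl) ◅ w) with ~-∷ w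
  ... | inj₁ av              = inj₂ (inj₂ (ε , av))
  ... | inj₂ (inj₁ (_ , bv)) = inj₁ bv
  ... | inj₂ (inj₂ (_ , av)) = inj₂ (inj₂ (ε , av))

  NotLeast : List (Edge n) → Fin n → Set
  NotLeast E v = ∃ λ u → u Fin.< v × u ~[ E ] v

  EntersVia : Fin n → Fin n → List (Edge n) → Fin n → Set
  EntersVia a b E v = ∃ λ u → u Fin.< v × u ~[ E ] a × b ~[ E ] v

  NotLeastVia : Edge n → List (Edge n) → Fin n → Set
  NotLeastVia (a , b) E v = EntersVia a b E v ⊎ EntersVia b a E v

  NotLeast-∷ : ∀ {e E v} → NotLeast (e ∷ E) v → NotLeast E v ⊎ NotLeastVia e E v
  NotLeast-∷ (u , u<v , w) with ~-∷ w
  ... | inj₁ w′               = inj₁ (u , u<v , w′)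
  ... | inj₂ (inj₁ (ua , bv)) = inj₂ (inj₁ (u , u<v , ua , bv))
  ... | inj₂ (inj₂ (ub , av)) = inj₂ (inj₂ (u , u<v , ub , av))

  distinct-~⇒NotLeast : ∀ {E y z} → y ≢ z → y ~[ E ] z → NotLeast E y ⊎ NotLeast E z
  distinct-~⇒NotLeast {y = y} {z} y≢z y~z with Fin.<-cmp y z
  ... | tri< y<z _ _ = inj₂ (y , y<z , y~z)
  ... | tri≈ _ y≡z _ = contradiction y≡z y≢z
  ... | tri> _ _ z<y = inj₁ (z , z<y , ~-sym y~z)

  EntersVia-opposite : ∀ {a b E y z} → EntersVia a b E y → EntersVia b a E z →
                       NotLeast E y ⊎ NotLeast E z
  EntersVia-opposite {y = y} {z} (u , u<y , ua , by) (u′ , u′<z , u′b , az) with y Fin.<? z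
  ... | yes y<z = inj₂ (u , Fin.<-trans u<y y<z , ua ◅◅ az)
  ... | no  y≮z = inj₁ (u′ , ℕ.<-≤-trans u′<z (ℕ.≮⇒≥ y≮z) , u′b ◅◅ by)

  NotLeastVia-pair : ∀ {e E y z} → y ≢ z → NotLeastVia e E y → NotLeastVia e E z →
                     NotLeast E y ⊎ NotLeast E z
  NotLeastVia-pair y≢z (inj₁ (_ , _ , _ , by)) (inj₁ (_ , _ , _ , bz)) =
    distinct-~⇒NotLeast y≢z (~-sym by ◅◅ bz)
  NotLeastVia-pair y≢z (inj₂ (_ , _ , _ , ay)) (inj₂ (_ , _ , _ , az)) =
    distinct-~⇒NotLeast y≢z (~-sym ay ◅◅ az)
  NotLeastVia-pair _ (inj₁ p) (inj₂ q) = EntersVia-opposite p q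
  NotLeastVia-pair _ (inj₂ p) (inj₁ q) = EntersVia-opposite p q

  AllBut : Fin n → (Fin n → Set) → List (Fin n) → Set
  AllBut w P = All (λ y → y ≡ w ⊎ P y)

  at-most-one-NotLeastVia : ∀ {e E} L → All (λ y → NotLeast E y ⊎ NotLeastVia e E y) L →
                            All (NotLeast E) L ⊎
                            ∃ λ w → NotLeastVia e E w × AllBut w (NotLeast E) L
  at-most-one-NotLeastVia [] [] = inj₁ []
  at-most-one-NotLeastVia (x ∷ xs) (px ∷ pxs) with at-most-one-NotLeastVia xs pxs | px
  ... | inj₁ nl            | inj₁ nlx = inj₁ (nlx ∷ nl)
  ... | inj₁ nl            | inj₂ vx  = inj₂ (x , vx , inj₁ refl ∷ All.map inj₂ nl)
  ... | inj₂ (w , vw , nl) | inj₁ nlx = inj₂ (w , vw , inj₂ nlx ∷ nl)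
  ... | inj₂ (w , vw , nl) | inj₂ vx with x Fin.≟ w
  ...   | yes x≡w = inj₂ (w , vw , inj₁ x≡w ∷ nl)
  ...   | no  x≢w with NotLeastVia-pair x≢w vx vw
  ...     | inj₁ nlx = inj₂ (w , vw , inj₂ nlx ∷ nl)
  ...     | inj₂ nlw =
    inj₂ (x , vx , inj₁ refl ∷ All.map Sum.[ (λ { refl → inj₂ nlw }) , inj₂ ] nl)

  ≢? : (w : Fin n) → Decidable (_≢ w)
  ≢? w y = ¬? (y Fin.≟ w)

  without : Fin n → List (Fin n) → List (Fin n)
  without w = filter (≢? w)

  length≤1+length-without : ∀ w {L} → Unique L → length L ≤ suc (length (without w L))
  length≤1+length-without w {[]} [] = z≤n
  length≤1+length-without w {x ∷ xs} (x∉xs ∷ uxs) with x Fin.≟ w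
  ... | yes refl rewrite filter-all (≢? w) (All.map (λ w≢y → w≢y ∘ sym) x∉xs) = ℕ.≤-refl
  ... | no _ = s≤s (length≤1+length-without w uxs)

  AllBut⇒All-without : ∀ w {P L} → AllBut w P L → All P (without w L)
  AllBut⇒All-without w {L = L} ps =
    All.map (λ { (p , y≢w) → Sum.[ (λ y≡w → contradiction y≡w y≢w) , id ] p })
            (All.zip (All.filter⁺ (≢? w) ps , All.all-filter (≢? w) L))

  length-NotLeast≤length-edges : ∀ E {L} → Unique L → All (NotLeast E) L → length L ≤ length E
  length-NotLeast≤length-edges [] {[]} _ _ = z≤n
  length-NotLeast≤length-edges [] {_ ∷ _} _ ((_ , u<u , ε) ∷ _) =
    contradiction u<u (Fin.<-irrefl refl)
  length-NotLeast≤length-edges [] {_ ∷ _} _ ((_ , _ , inj₁ () ◅ _) ∷ _)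
  length-NotLeast≤length-edges [] {_ ∷ _} _ ((_ , _ , inj₂ () ◅ _) ∷ _)
  length-NotLeast≤length-edges (_ ∷ E) {L} uL nlL
    with at-most-one-NotLeastVia L (All.map NotLeast-∷ nlL)
  ... | inj₁ nl = ℕ.m≤n⇒m≤1+n (length-NotLeast≤length-edges E uL nl)
  ... | inj₂ (w , _ , nl) = ℕ.≤-trans (length≤1+length-without w uL)
    (s≤s (length-NotLeast≤length-edges E (Unique.filter⁺ (≢? w) uL) (AllBut⇒All-without w nl)))

precedesInComponent : ∀ {n} → List (Edge n) → Fin n → Fin n → Bool
precedesInComponent E v u = (toℕ u <ᵇ toℕ v) ∧ sameComp E u v

isLeast : ∀ {n} → List (Edge n) → Fin n → Bool
isLeast {n} E v = all (not ∘ precedesInComponent E v) (allFin n)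

¬T-not⇒T : ∀ {b} → ¬ T (not b) → T b
¬T-not⇒T {true}  _  = _
¬T-not⇒T {false} ¬t = ¬t _

¬isLeast⇒NotLeast : ∀ {n} (E : List (Edge n)) {v} → ¬ T (isLeast E v) → NotLeast E v
¬isLeast⇒NotLeast {n} E {v} ¬least
  with u , ¬t ← satisfied (All.¬All⇒Any¬ (T? ∘ _) (allFin n) (¬least ∘ All.all⁻ _))
  with u<v , u~v ← Equivalence.to T-∧ (¬T-not⇒T ¬t)
  = u , ℕ.<ᵇ⇒< (toℕ u) (toℕ v) u<v , reach⇒~ E n u~v

length-filter+length-filter-∁ : ∀ {A : Set} {P : A → Set} (P? : Decidable P) xs →
  length (filter P? xs) + length (filter (∁? P?) xs) ≡ length xs
length-filter+length-filter-∁ P? [] = refl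
length-filter+length-filter-∁ P? (x ∷ xs) with P? x
... | yes _ = cong suc (length-filter+length-filter-∁ P? xs)
... | no  _ = trans (ℕ.+-suc _ _) (cong suc (length-filter+length-filter-∁ P? xs))

length-allFin : ∀ n → length (allFin n) ≡ n
length-allFin n = length-tabulate id

vertices≤components+edges : ∀ n (E : List (Edge n)) → n ≤ components n E + length E
vertices≤components+edges n E = begin
  n                                ≡⟨ length-allFin n ⟨
  length (allFin n)                ≡⟨ length-filter+length-filter-∁ least? (allFin n) ⟨
  components n E + length nonLeast ≤⟨ ℕ.+-monoʳ-≤ (components n E) nonLeast≤edges ⟩
  components n E + length E        ∎
  where
  open ℕ.≤-Reasoning
  least? = T? ∘ isLeast E
  nonLeast = filter (∁? least?) (allFin n)
  nonLeast≤edges : length nonLeast ≤ length E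
  nonLeast≤edges = length-NotLeast≤length-edges E
    (Unique.filter⁺ (∁? least?) (Unique.allFin⁺ n))
    (All.map (¬isLeast⇒NotLeast E) (All.all-filter (∁? least?) (allFin n)))

components≤vertices : ∀ n (E : List (Edge n)) → components n E ≤ n
components≤vertices n E =
  ℕ.≤-trans (length-filter (T? ∘ isLeast E) (allFin n)) (ℕ.≤-reflexive (length-allFin n))

1≤components : ∀ n (E : List (Edge (suc n))) → 1 ≤ components (suc n) E
1≤components n E = subst (λ vs → 1 ≤ length vs)
  (sym (filter-accept (T? ∘ isLeast E) {Fin.zero} {tabulate Fin.suc} zero-isLeast)) (s≤s z≤n)
  where
  zero-isLeast : T (isLeast E Fin.zero)
  zero-isLeast = All.all⁻ (not ∘ precedesInComponent E Fin.zero) (All.universal _ (allFin (suc n)))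

T-≡ᵇ : ∀ {m n} → T (m ≡ᵇ n) ⇔ m ≡ n
T-≡ᵇ = mk⇔ (ℕ.≡ᵇ⇒≡ _ _) (ℕ.≡⇒≡ᵇ _ _)

T-≡ᵇ∧≡ᵇ : ∀ {a b c d} → T ((a ≡ᵇ b) ∧ (c ≡ᵇ d)) ⇔ (a ≡ b × c ≡ d)
T-≡ᵇ∧≡ᵇ = ⇔.trans T-∧ (T-≡ᵇ ×-⇔ T-≡ᵇ)

-- For a spanning subgraph H with c components and l edges of a connected graph G on suc n
-- vertices, n ∸ (suc n ∸ c) is r(G) − r(H) and (l + c) ∸ suc n is c(H).
rank-corank⇔connected-size : ∀ n {c l} j → 1 ≤ c → c ≤ suc n → suc n ≤ c + l →
  (n ∸ (suc n ∸ c) ≡ 0 × (l + c) ∸ suc n ≡ j) ⇔ (c ≡ 1 × l ≡ n + j)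
rank-corank⇔connected-size n {suc zero} {l} j _ _ (s≤s n≤l) =
  mk⇔ (λ (_ , e) → refl , corank⇒size e) (λ (_ , e) → ℕ.n∸n≡0 n , size⇒corank e)
  where
  corank≡l∸n : (l + 1) ∸ suc n ≡ l ∸ n
  corank≡l∸n = cong (_∸ suc n) (ℕ.+-comm l 1)
  corank⇒size : (l + 1) ∸ suc n ≡ j → l ≡ n + j
  corank⇒size e = trans (sym (ℕ.m+[n∸m]≡n n≤l)) (cong (n +_) (trans (sym corank≡l∸n) e))
  size⇒corank : l ≡ n + j → (l + 1) ∸ suc n ≡ j
  size⇒corank e = trans corank≡l∸n (trans (cong (_∸ n) e) (ℕ.m+n∸m≡n n j))
rank-corank⇔connected-size n {suc (suc c)} j _ (s≤s 1+c≤n) _ =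
  mk⇔ (λ (e , _) → contradiction (trans (sym (ℕ.m∸[m∸n]≡n 1+c≤n)) e) ℕ.1+n≢0) (λ ())

rank-connected : ∀ {n} {G : SimpleGraph (suc n)} → Connected G → rank (suc n) (edges G) ≡ n
rank-connected conn = cong (suc _ ∸_) conn

whitneyTerm⇔N1Term : ∀ {n r} → r ≡ n → ∀ j (H : List (Edge (suc n))) →
  T (((r ∸ rank (suc n) H) ≡ᵇ 0) ∧ (corank (suc n) H ≡ᵇ j)) ⇔
  T ((components (suc n) H ≡ᵇ 1) ∧ (length H ≡ᵇ n + j))
whitneyTerm⇔N1Term {n} refl j H = ⇔.trans T-≡ᵇ∧≡ᵇ (⇔.trans
  (rank-corank⇔connected-size n j (1≤components n H) (components≤vertices (suc n) H)
                                  (vertices≤components+edges (suc n) H))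
  (⇔.sym T-≡ᵇ∧≡ᵇ))

N1≡whitneyCoef : ∀ {n} (G : SimpleGraph (suc n)) → Connected G → ∀ j →
                 N1 G (n + j) ≡ whitneyCoef G 0 j
N1≡whitneyCoef G conn j = cong length (filter-≐ (T? ∘ _) (T? ∘ _)
  ((λ {H} → Equivalence.from (term⇔ H)) , (λ {H} → Equivalence.to (term⇔ H))) (spanning G))
  where term⇔ = whitneyTerm⇔N1Term (rank-connected {G = G} conn) j

N1≡0-below-rank : ∀ {n i} (G : SimpleGraph (suc n)) → i < n → N1 G i ≡ 0
N1≡0-below-rank {n} {i} G i<n =
  cong length (filter-none (T? ∘ _) (All.universal too-small (spanning G)))
  where
  too-small : ∀ H → ¬ T ((components (suc n) H ≡ᵇ 1) ∧ (length H ≡ᵇ i))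
  too-small H t with c≡1 , l≡i ← Equivalence.to T-≡ᵇ∧≡ᵇ t =
    ℕ.<⇒≱ i<n (subst (n ≤_) l≡i (ℕ.≤-pred
      (subst (λ c → suc n ≤ c + length H) c≡1 (vertices≤components+edges (suc n) H))))

toℚᵘ-ℕtoℚ : ∀ a → toℚᵘ (ℕtoℚ a) ≃ᵘ mkℚᵘ (ℤ.+ a) 0
toℚᵘ-ℕtoℚ a = ℚ.toℚᵘ-fromℚᵘ (mkℚᵘ (ℤ.+ a) 0)

ℕtoℚ-mono-≤ : ∀ {a b} → a ≤ b → ℕtoℚ a ℚ.≤ ℕtoℚ b
ℕtoℚ-mono-≤ {a} {b} a≤b = ℚ.toℚᵘ-cancel-≤
  (ℚᵘ.≤-respˡ-≃ (ℚᵘ.≃-sym (toℚᵘ-ℕtoℚ a)) (ℚᵘ.≤-respʳ-≃ (ℚᵘ.≃-sym (toℚᵘ-ℕtoℚ b)) (ℚᵘ.*≤*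
    (subst₂ ℤ._≤_ (sym (ℤ.*-identityʳ (ℤ.+ a))) (sym (ℤ.*-identityʳ (ℤ.+ b))) (ℤ.+≤+ a≤b)))))

ℕtoℚ-mono-< : ∀ {a b} → a < b → ℕtoℚ a ℚ.< ℕtoℚ b
ℕtoℚ-mono-< {a} {b} a<b = ℚ.toℚᵘ-cancel-<
  (ℚᵘ.<-respˡ-≃ (ℚᵘ.≃-sym (toℚᵘ-ℕtoℚ a)) (ℚᵘ.<-respʳ-≃ (ℚᵘ.≃-sym (toℚᵘ-ℕtoℚ b)) (ℚᵘ.*<*
    (subst₂ ℤ._<_ (sym (ℤ.*-identityʳ (ℤ.+ a))) (sym (ℤ.*-identityʳ (ℤ.+ b))) (ℤ.+<+ a<b)))))

ℕtoℚ-cancel-≤ : ∀ {a b} → ℕtoℚ a ℚ.≤ ℕtoℚ b → a ≤ b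
ℕtoℚ-cancel-≤ {a} {b} qa≤qb with a ℕ.≤? b
... | yes a≤b = a≤b
... | no  a≰b =
  contradiction (ℚ.≤-<-trans qa≤qb (ℕtoℚ-mono-< (ℕ.≰⇒> a≰b))) (ℚ.<-irrefl refl)

0≤p-q⇒q≤p : ∀ {p q} → 0ℚ ℚ.≤ p ℚ.- q → q ℚ.≤ p
0≤p-q⇒q≤p {p} {q} 0≤p-q = subst₂ ℚ._≤_ (ℚ.+-identityˡ q) p-q+q≡p (ℚ.+-monoˡ-≤ q 0≤p-q)
  where
  open ≡-Reasoning
  p-q+q≡p : p ℚ.- q ℚ.+ q ≡ p
  p-q+q≡p = begin
    p ℚ.- q ℚ.+ q       ≡⟨ ℚ.+-assoc p (ℚ.- q) q ⟩
    p ℚ.+ (ℚ.- q ℚ.+ q) ≡⟨ cong (p ℚ.+_) (ℚ.+-inverseˡ q) ⟩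
    p ℚ.+ 0ℚ            ≡⟨ ℚ.+-identityʳ p ⟩
    p                   ∎

whitneyCoef-x⁰-≤ : ∀ {n} {G H : SimpleGraph n} {Q} → WhitneyDiffFactors G H Q →
                   ∀ j → whitneyCoef H 0 j ≤ whitneyCoef G 0 j
whitneyCoef-x⁰-≤ {Q = Q} factors j =
  ℕtoℚ-cancel-≤ (0≤p-q⇒q≤p (subst (0ℚ ℚ.≤_) (sym (factors 0 j)) (nonneg Q 0 j)))

WhitneyMaximum⇒ZeroElement : ∀ {n m G} → WhitneyMaximum n m G → ZeroElement n m G
WhitneyMaximum⇒ZeroElement {zero} ((() , _) , _)
WhitneyMaximum⇒ZeroElement {suc n} {m} {G} (inG , factors) =
  inG , λ H inH i _ → N1-≤ H inH i (n ℕ.≤? i)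
  where
  N1-≤ : ∀ H → InC (suc n) m H → ∀ i → Dec (n ≤ i) → N1 H i ≤ N1 G i
  N1-≤ H _ i (no i≱n) = ℕ.≤-trans (ℕ.≤-reflexive (N1≡0-below-rank H (ℕ.≰⇒> i≱n))) z≤n
  N1-≤ H inH i (yes n≤i) = subst (λ k → N1 H k ≤ N1 G k) (ℕ.m+[n∸m]≡n n≤i) (begin
    N1 H (n + j)      ≡⟨ N1≡whitneyCoef H (proj₁ inH) j ⟩
    whitneyCoef H 0 j ≤⟨ whitneyCoef-x⁰-≤ {G = G} {H} (proj₂ (factors H inH)) j ⟩
    whitneyCoef G 0 j ≡⟨ N1≡whitneyCoef G (proj₁ inG) j ⟨
    N1 G (n + j)      ∎)
    where
    open ℕ.≤-Reasoning
    j = i ∸ n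

weightedSum : (ℕ → ℚ) → (ℕ → ℕ) → List ℕ → ℚ
weightedSum w f L = foldr ℚ._+_ 0ℚ (map (λ i → ℕtoℚ (f i) ℚ.* w i) L)

weightedSum-mono-≤ : ∀ {w f g} L → (∀ i → ℚ.NonNegative (w i)) → All (λ i → f i ≤ g i) L →
                     weightedSum w f L ℚ.≤ weightedSum w g L
weightedSum-mono-≤ [] _ [] = ℚ.≤-refl
weightedSum-mono-≤ {w} (i ∷ L) w≥0 (fi≤gi ∷ f≤g) =
  ℚ.+-mono-≤ (ℚ.*-monoʳ-≤-nonNeg (w i) {{w≥0 i}} (ℕtoℚ-mono-≤ fi≤gi))
             (weightedSum-mono-≤ L w≥0 f≤g)

weightedSum-mono-< : ∀ {w f g} L → (∀ i → ℚ.Positive (w i)) → All (λ i → f i ≤ g i) L →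
                     Any (λ i → f i < g i) L → weightedSum w f L ℚ.< weightedSum w g L
weightedSum-mono-< {w} (i ∷ L) w>0 (_ ∷ f≤g) (here fi<gi) =
  ℚ.+-mono-<-≤ (ℚ.*-monoˡ-<-pos (w i) {{w>0 i}} (ℕtoℚ-mono-< fi<gi))
               (weightedSum-mono-≤ L (λ k → ℚ.pos⇒nonNeg (w k) {{w>0 k}}) f≤g)
weightedSum-mono-< {w} (i ∷ L) w>0 (fi≤gi ∷ f≤g) (there f<g) =
  ℚ.+-mono-≤-< (ℚ.*-monoʳ-≤-nonNeg (w i) {{ℚ.pos⇒nonNeg (w i) {{w>0 i}}}} (ℕtoℚ-mono-≤ fi≤gi))
               (weightedSum-mono-< L w>0 f≤g f<g)

weightedSum-≤⇒pointwise-≥ : ∀ {w f g} L → (∀ i → ℚ.Positive (w i)) →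
                            All (λ i → f i ≤ g i) L → weightedSum w g L ℚ.≤ weightedSum w f L →
                            All (λ i → g i ≤ f i) L
weightedSum-≤⇒pointwise-≥ {f = f} {g} L w>0 f≤g Σg≤Σf = All.tabulate g≤f
  where
  g≤f : ∀ {i} → i ∈ L → g i ≤ f i
  g≤f {i} i∈L with g i ℕ.≤? f i
  ... | yes gi≤fi = gi≤fi
  ... | no  gi≰fi = contradiction
    (ℚ.<-≤-trans (weightedSum-mono-< L w>0 f≤g (lose i∈L (ℕ.≰⇒> gi≰fi))) Σg≤Σf)
    (ℚ.<-irrefl refl)

halfWeight : ℕ → ℕ → ℚ
halfWeight m i = (½ ^ℚ i) ℚ.* ((1ℚ ℚ.- ½) ^ℚ (m ∸ i))

reliability-½ : ∀ {n m} (G : SimpleGraph n) → numEdges G ≡ m →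
                reliability G ½ ≡ weightedSum (halfWeight m) (N1 G) (upTo (suc m))
reliability-½ G refl = refl

^ℚ-pos : ∀ p .{{_ : ℚ.Positive p}} k → ℚ.Positive (p ^ℚ k)
^ℚ-pos p zero    = _
^ℚ-pos p (suc k) = ℚ.pos*pos⇒pos p (p ^ℚ k) {{^ℚ-pos p k}}

halfWeight-pos : ∀ m i → ℚ.Positive (halfWeight m i)
halfWeight-pos m i = ℚ.pos*pos⇒pos (½ ^ℚ i) {{^ℚ-pos ½ i}} _ {{^ℚ-pos (1ℚ ℚ.- ½) (m ∸ i)}}

UniformlyMostReliable⇒ZeroElement : ∀ {n m} {G Z : SimpleGraph n} →
  UniformlyMostReliable n m G → ZeroElement n m Z → ZeroElement n m G
UniformlyMostReliable⇒ZeroElement {m = m} {G} {Z} (inG , mostReliable) (inZ , Z-max) =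
  inG , λ H inH i i≤m →
    ℕ.≤-trans (Z-max H inH i i≤m) (All.lookup N1Z≤N1G (∈-upTo⁺ (s≤s i≤m)))
  where
  range = upTo (suc m)
  N1G≤N1Z : All (λ i → N1 G i ≤ N1 Z i) range
  N1G≤N1Z = All.tabulate (λ i∈ → Z-max G inG _ (ℕ.≤-pred (∈-upTo⁻ i∈)))
  R[Z]≤R[G] : weightedSum (halfWeight m) (N1 Z) range ℚ.≤ weightedSum (halfWeight m) (N1 G) range
  R[Z]≤R[G] = subst₂ ℚ._≤_ (reliability-½ Z (proj₂ inZ)) (reliability-½ G (proj₂ inG))
                (mostReliable Z inZ ½ (ℚ.*≤* (ℤ.+≤+ z≤n)) (ℚ.*≤* (ℤ.+≤+ (s≤s z≤n))))
  N1Z≤N1G : All (λ i → N1 Z i ≤ N1 G i) range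
  N1Z≤N1G = weightedSum-≤⇒pointwise-≥ range (halfWeight-pos m) N1G≤N1Z R[Z]≤R[G]

proposition1 : (n m : ℕ) →
    ∃ (λ (G : SimpleGraph n) → WhitneyMaximum n m G) →
    ∀ (G : SimpleGraph n) → UniformlyMostReliable n m G → ZeroElement n m G
proposition1 n m (G* , whitneyMaximum) G mostReliable =
  UniformlyMostReliable⇒ZeroElement {G = G} {G*} mostReliable
    (WhitneyMaximum⇒ZeroElement {G = G*} whitneyMaximum)
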